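{- Let $\alpha<\varepsilon_0$ be an ordinal and $f:\mathbb N\to\mathbb N$ a function in $\mathscr F_{<\alpha}$. Then there exists $g:\mathbb N\to\mathbb N$ in $\mathscr F_{<\alpha}$ such that $f(F_\alpha(x))\le F_\alpha(g(x))$ for all $x\in\mathbb N$.
   Context: Ordinals are below $\varepsilon_0$ in Cantor normal form; limit ordinals have fundamental sequences $(\gamma+\omega^{\beta+1})(x)=\gamma+\omega^\beta\cdot(x+1)$, $(\gamma+\omega^{\lambda'})(x)=\gamma+\omega^{\lambda'(x)}$ for $\lambda'$ limit. Fast-growing functions: $F_0(x)=x+1$, $F_{\alpha+1}(x)=F_\alpha^{x+1}(x)$, $F_\lambda(x)=F_{\lambda(x)}(x)$. Extended Grzegorczyk class $\mathscr F_\alpha$: smallest class of functions $\mathbb N^k\to\mathbb N$ containing the zero function, addition, projections and $F_\alpha$, closed under composition and limited primitive recursion (primitive recursion bounded by some function of the class applied to the max of the arguments). $\mathscr F_{<\alpha}=\bigcup_{\beta<\alpha}\mathscr F_\beta$. -}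

module Defs where

open import Data.Nat using (ℕ; zero; suc; _+_; _≤_; _⊔_)
open import Data.Fin using (Fin)
open import Data.Vec using (Vec; []; _∷_; lookup; tabulate; head)
open import Data.Product using (Σ; _×_)
open import Data.Sum using (_⊎_)
open import Relation.Binary.PropositionalEquality using (_≡_)

-- Ordinal notations below ε₀ in Cantor normal form.
-- ω^ a + b  denotes  ω^a + b  (a term ω^a₁ + (ω^a₂ + (… + 0))).

data Ord : Set where
  𝟎    : Ord
  ω^_+_ : Ord → Ord → Ord

-- Ordinal order on CNF terms (lexicographic; correct for normal forms).
data _<ₒ_ : Ord → Ord → Set where
  0<ω  : ∀ {a b} → 𝟎 <ₒ (ω^ a + b)
  exp< : ∀ {a b c d} → a <ₒ c → (ω^ a + b) <ₒ (ω^ c + d)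
  tl<  : ∀ {a b d} → b <ₒ d → (ω^ a + b) <ₒ (ω^ a + d)

_≤ₒ_ : Ord → Ord → Set
a ≤ₒ b = (a <ₒ b) ⊎ (a ≡ b)

data LeadLe (a : Ord) : Ord → Set where
  lz : LeadLe a 𝟎
  ls : ∀ {c d} → c ≤ₒ a → LeadLe a (ω^ c + d)

data IsCNF : Ord → Set where
  cnf0 : IsCNF 𝟎
  cnfω : ∀ {a b} → IsCNF a → IsCNF b → LeadLe a b → IsCNF (ω^ a + b)

-- To obtain a structurally terminating definition we translate CNF
-- notations into Brouwer trees whose limit nodes are exactly the
-- fundamental sequences of the paper:
--   (γ + ω^(β+1))(x) = γ + ω^β·(x+1),   (γ + ω^λ')(x) = γ + ω^(λ'(x)).

data Brw : Set where
  bz : Brw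
  bs : Brw → Brw
  bl : (ℕ → Brw) → Brw

_⊕_ : Brw → Brw → Brw
x ⊕ bz   = x
x ⊕ bs y = bs (x ⊕ y)
x ⊕ bl f = bl (λ n → x ⊕ f n)

rep : ℕ → Brw → Brw
rep zero    y = y
rep (suc n) y = y ⊕ rep n y

ωexp : Brw → Brw
ωexp bz     = bs bz
ωexp (bs y) = bl (λ n → rep n (ωexp y))
ωexp (bl f) = bl (λ n → ωexp (f n))

toB : Ord → Brw
toB 𝟎          = bz
toB (ω^ a + b) = ωexp (toB a) ⊕ toB b

iter : ℕ → (ℕ → ℕ) → ℕ → ℕ
iter zero    h x = x
iter (suc n) h x = h (iter n h x)

FB : Brw → ℕ → ℕ
FB bz     x = suc x
FB (bs a) x = iter (suc x) (FB a) x
FB (bl f) x = FB (f x) x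

F : Ord → ℕ → ℕ
F α = FB (toB α)

-- Extended Grzegorczyk classes 𝓕_β (functions ℕ^k → ℕ as Vec ℕ k → ℕ).

vmax : ∀ {k} → Vec ℕ k → ℕ
vmax []       = 0
vmax (x ∷ xs) = x ⊔ vmax xs

prec : ∀ {k} → (Vec ℕ k → ℕ) → (Vec ℕ (suc (suc k)) → ℕ) → Vec ℕ (suc k) → ℕ
prec g h (zero  ∷ xs) = g xs
prec g h (suc y ∷ xs) = h (y ∷ prec g h (y ∷ xs) ∷ xs)

data Grz (β : Ord) : (k : ℕ) → (Vec ℕ k → ℕ) → Set where
  zeroG : ∀ {k} → Grz β k (λ _ → 0)
  addG  : Grz β 2 (λ v → lookup v Fin.zero + lookup v (Fin.suc Fin.zero))
  projG : ∀ {k} (i : Fin k) → Grz β k (λ v → lookup v i)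
  FG    : Grz β 1 (λ v → F β (head v))
  compG : ∀ {k m} {h : Vec ℕ m → ℕ} {gs : Fin m → Vec ℕ k → ℕ} →
          Grz β m h → (∀ i → Grz β k (gs i)) →
          Grz β k (λ v → h (tabulate (λ i → gs i v)))
  lprecG : ∀ {k} {g : Vec ℕ k → ℕ} {h : Vec ℕ (suc (suc k)) → ℕ} {b : Vec ℕ 1 → ℕ} →
          Grz β k g → Grz β (suc (suc k)) h → Grz β 1 b →
          (∀ v → prec g h v ≤ b (vmax v ∷ [])) →
          Grz β (suc k) (prec g h)
  extG  : ∀ {k} {f f' : Vec ℕ k → ℕ} → Grz β k f → (∀ v → f v ≡ f' v) → Grz β k f'

Grz< : Ord → (k : ℕ) → (Vec ℕ k → ℕ) → Set
Grz< α k f = Σ Ord (λ β → IsCNF β × (β <ₒ α) × Grz β k f)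

module Submission where

open import Defs
open import Data.Nat using (ℕ; zero; suc; _+_; _≤_; z≤n; s≤s; _≤′_; ≤′-refl; ≤′-step)
open import Data.Nat.Properties
open import Data.Fin using (Fin) renaming (zero to fz; suc to fs)
open import Data.Vec using (Vec; []; _∷_; head; lookup; tabulate)
open import Data.Product using (Σ; _×_; _,_; proj₁; proj₂)
open import Data.Sum using (inj₁; inj₂)
open import Relation.Binary.PropositionalEquality using (_≡_; refl; sym; cong; subst)

-- Write b ≼ₙ a when b is reached from a by taking predecessors and n-th
-- terms of fundamental sequences. For the fundamental sequences used here
-- one has F_b(F_a(x)) ≤ F_a(x+1) whenever b+1 ≼ₙ a and n ≤ x, and every
-- β < α in Cantor normal form satisfies β+1 ≼_N α for some N. Hence
-- F_β ∘ F_α ≤ F_α ∘ F_β^(N+1), and similarly y ↦ 2y is majorised over F_α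
-- by a function of 𝓕_β. Induction on the derivation of f ∈ 𝓕_β then gives
-- g ∈ 𝓕_β with f(v) ≤ F_α(g(x)) whenever max v ≤ F_α(x): the majorants of
-- the inner functions of a composition are added, and a limited recursion
-- is majorised through its bound.

data _≼[_]_ : Brw → ℕ → Brw → Set where
  ≼-refl : ∀ {a n} → a ≼[ n ] a
  ≼-suc  : ∀ {a b n} → b ≼[ n ] a → b ≼[ n ] bs a
  ≼-lim  : ∀ {f b n} → b ≼[ n ] f n → b ≼[ n ] bl f

≼-trans : ∀ {a b c n} → c ≼[ n ] b → b ≼[ n ] a → c ≼[ n ] a
≼-trans p ≼-refl    = p
≼-trans p (≼-suc q) = ≼-suc (≼-trans p q)
≼-trans p (≼-lim q) = ≼-lim (≼-trans p q)

suc≼⇒≼ : ∀ {a b n} → bs b ≼[ n ] a → b ≼[ n ] a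
suc≼⇒≼ = ≼-trans (≼-suc ≼-refl)

suc≼suc⇒≼ : ∀ {a b n} → bs b ≼[ n ] bs a → b ≼[ n ] a
suc≼suc⇒≼ ≼-refl    = ≼-refl
suc≼suc⇒≼ (≼-suc p) = suc≼⇒≼ p

bz≼ : ∀ a {n} → bz ≼[ n ] a
bz≼ bz         = ≼-refl
bz≼ (bs a)     = ≼-suc (bz≼ a)
bz≼ (bl f) {n} = ≼-lim (bz≼ (f n))

⊕-monoʳ-≼ : ∀ c {a b n} → b ≼[ n ] a → (c ⊕ b) ≼[ n ] (c ⊕ a)
⊕-monoʳ-≼ c ≼-refl    = ≼-refl
⊕-monoʳ-≼ c (≼-suc p) = ≼-suc (⊕-monoʳ-≼ c p)
⊕-monoʳ-≼ c (≼-lim p) = ≼-lim (⊕-monoʳ-≼ c p)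

c≼c⊕d : ∀ c d {n} → c ≼[ n ] (c ⊕ d)
c≼c⊕d c d = ⊕-monoʳ-≼ c (bz≼ d)

≼-chain : ∀ {f : ℕ → Brw} {m} → (∀ n → f n ≼[ m ] f (suc n)) →
          ∀ {n n'} → n ≤ n' → f n ≼[ m ] f n'
≼-chain {f} {m} step n≤n' = go (≤⇒≤′ n≤n')
  where
    go : ∀ {n n'} → n ≤′ n' → f n ≼[ m ] f n'
    go ≤′-refl      = ≼-refl
    go (≤′-step le) = ≼-trans (go le) (step _)

data Regular : Brw → Set where
  reg-zero : Regular bz
  reg-suc  : ∀ {a} → Regular a → Regular (bs a)
  reg-lim  : ∀ {f} → (∀ n → Regular (f n)) →
             (∀ n m → f n ≼[ m ] f (suc n)) →
             (∀ n m → bs (f n) ≼[ suc m ] f (suc n)) → Regular (bl f)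

≼-index-mono : ∀ {a b n m} → Regular a → b ≼[ n ] a → n ≤ m → b ≼[ m ] a
≼-index-mono _                   ≼-refl    _   = ≼-refl
≼-index-mono (reg-suc r)         (≼-suc p) n≤m = ≼-suc (≼-index-mono r p n≤m)
≼-index-mono {m = m} (reg-lim rf inc _) (≼-lim {n = n} p) n≤m =
  ≼-lim (≼-trans (≼-index-mono (rf n) p n≤m) (≼-chain (λ k → inc k m) n≤m))

y≼rep : ∀ k y {m} → y ≼[ m ] rep k y
y≼rep zero    y = ≼-refl
y≼rep (suc k) y = c≼c⊕d y (rep k y)

rep≼rep-suc : ∀ k y {m} → rep k y ≼[ m ] rep (suc k) y
rep≼rep-suc zero    y = c≼c⊕d y y
rep≼rep-suc (suc k) y = ⊕-monoʳ-≼ y (rep≼rep-suc k y)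

rep-mono : ∀ y {k k' m} → k ≤ k' → rep k y ≼[ m ] rep k' y
rep-mono y = ≼-chain (λ k → rep≼rep-suc k y)

suc-rep≼rep-suc : ∀ k y {m} → bs bz ≼[ m ] y → bs (rep k y) ≼[ m ] rep (suc k) y
suc-rep≼rep-suc zero    y p = ⊕-monoʳ-≼ y p
suc-rep≼rep-suc (suc k) y p = ⊕-monoʳ-≼ y (suc-rep≼rep-suc k y p)

one≼ωexp : ∀ b {m} → bs bz ≼[ m ] ωexp b
one≼ωexp bz         = ≼-refl
one≼ωexp (bs b) {m} = ≼-lim (≼-trans (one≼ωexp b) (y≼rep m (ωexp b)))
one≼ωexp (bl f) {m} = ≼-lim (one≼ωexp (f m))

ωexp-mono-≼ : ∀ {a b m} → b ≼[ m ] a → ωexp b ≼[ m ] ωexp a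
ωexp-mono-≼ ≼-refl                    = ≼-refl
ωexp-mono-≼ {m = m} (≼-suc {a = a} p) = ≼-lim (≼-trans (ωexp-mono-≼ p) (y≼rep m (ωexp a)))
ωexp-mono-≼ (≼-lim p)                 = ≼-lim (ωexp-mono-≼ p)

suc-ωexp≼ωexp-suc : ∀ c {m} → bs (ωexp c) ≼[ suc m ] ωexp (bs c)
suc-ωexp≼ωexp-suc c {m} = ≼-lim (⊕-monoʳ-≼ (ωexp c) (≼-trans (one≼ωexp c) (y≼rep m (ωexp c))))

Regular-⊕ : ∀ {c d} → Regular c → Regular d → Regular (c ⊕ d)
Regular-⊕ rc reg-zero              = rc
Regular-⊕ rc (reg-suc rd)          = reg-suc (Regular-⊕ rc rd)
Regular-⊕ {c} rc (reg-lim rf inc bach) =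
  reg-lim (λ n → Regular-⊕ rc (rf n))
          (λ n m → ⊕-monoʳ-≼ c (inc n m))
          (λ n m → ⊕-monoʳ-≼ c (bach n m))

Regular-rep : ∀ k {y} → Regular y → Regular (rep k y)
Regular-rep zero    ry = ry
Regular-rep (suc k) ry = Regular-⊕ ry (Regular-rep k ry)

Regular-ωexp : ∀ {b} → Regular b → Regular (ωexp b)
Regular-ωexp reg-zero            = reg-suc reg-zero
Regular-ωexp (reg-suc {a} r)     =
  reg-lim (λ n → Regular-rep n (Regular-ωexp r))
          (λ n m → rep≼rep-suc n (ωexp a))
          (λ n m → suc-rep≼rep-suc n (ωexp a) (one≼ωexp a))
Regular-ωexp (reg-lim {f} rf inc bach) =
  reg-lim (λ n → Regular-ωexp (rf n))
          (λ n m → ωexp-mono-≼ (inc n m))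
          (λ n m → ≼-trans (suc-ωexp≼ωexp-suc (f n)) (ωexp-mono-≼ (bach n m)))

Regular-toB : ∀ α → Regular (toB α)
Regular-toB 𝟎          = reg-zero
Regular-toB (ω^ a + b) = Regular-⊕ (Regular-ωexp (Regular-toB a)) (Regular-toB b)

mutual
  <ₒ⇒suc≼ : ∀ {β α} → IsCNF β → β <ₒ α → Σ ℕ λ N → bs (toB β) ≼[ N ] toB α
  <ₒ⇒suc≼ cnf0 (0<ω {a} {b}) = 0 , ≼-trans (one≼ωexp (toB a)) (c≼c⊕d (ωexp (toB a)) (toB b))
  <ₒ⇒suc≼ (cnfω {a} _ cb _) (tl< b<d) with <ₒ⇒suc≼ cb b<d
  ... | N , q = N , ⊕-monoʳ-≼ (ωexp (toB a)) q
  <ₒ⇒suc≼ (cnfω {a} {b} ca cb lb) (exp< {c = c} {d = d} a<c)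
    with <ₒ⇒suc≼ ca a<c | leadLe⇒≼rep cb lb
  ... | N₀ , a+1≼c | k , N₁ , b+1≼ωᵃk =
    suc P , ≼-trans β+1≼ωᵃ⁺¹ (≼-trans ωᵃ⁺¹≼ωᶜ (c≼c⊕d (ωexp (toB c)) (toB d)))
    where
      P = N₀ + N₁ + k
      ωᵃ = ωexp (toB a)
      -- the (P+1)-th term of the fundamental sequence of ω^(a+1) is ω^a·(P+2)
      β+1≼ωᵃ⁺¹ : bs (ωᵃ ⊕ toB b) ≼[ suc P ] ωexp (bs (toB a))
      β+1≼ωᵃ⁺¹ = ≼-lim (⊕-monoʳ-≼ ωᵃ (≼-trans
        (≼-index-mono (Regular-rep k (Regular-ωexp (Regular-toB a))) b+1≼ωᵃk
                      (m≤n⇒m≤1+n (m≤n⇒m≤n+o k (m≤n+m N₁ N₀))))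
        (rep-mono ωᵃ (m≤n+m k (N₀ + N₁)))))
      ωᵃ⁺¹≼ωᶜ : ωexp (bs (toB a)) ≼[ suc P ] ωexp (toB c)
      ωᵃ⁺¹≼ωᶜ = ωexp-mono-≼ (≼-index-mono (Regular-toB c) a+1≼c
                               (m≤n⇒m≤1+n (m≤n⇒m≤n+o k (m≤m+n N₀ N₁))))

  leadLe⇒≼rep : ∀ {a b} → IsCNF b → LeadLe a b →
                Σ ℕ λ k → Σ ℕ λ N → bs (toB b) ≼[ N ] rep k (ωexp (toB a))
  leadLe⇒≼rep {a} cnf0 lz = 0 , 0 , one≼ωexp (toB a)
  leadLe⇒≼rep {a} (cnfω _ cb lb) (ls (inj₂ refl)) with leadLe⇒≼rep cb lb
  ... | k , N , q = suc k , N , ⊕-monoʳ-≼ (ωexp (toB a)) q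
  leadLe⇒≼rep cβ@(cnfω _ _ _) (ls (inj₁ c<a)) with <ₒ⇒suc≼ cβ (exp< {d = 𝟎} c<a)
  ... | N , q = 0 , N , q

iter-inflationary : ∀ {h : ℕ → ℕ} → (∀ y → y ≤ h y) → ∀ n x → x ≤ iter n h x
iter-inflationary h≥ zero    x = ≤-refl
iter-inflationary h≥ (suc n) x = ≤-trans (iter-inflationary h≥ n x) (h≥ _)

iter-mono : ∀ {h : ℕ → ℕ} → (∀ {y z} → y ≤ z → h y ≤ h z) →
            ∀ n {x y} → x ≤ y → iter n h x ≤ iter n h y
iter-mono h-mono zero    x≤y = x≤y
iter-mono h-mono (suc n) x≤y = h-mono (iter-mono h-mono n x≤y)

iter-monoˡ : ∀ {h : ℕ → ℕ} → (∀ y → y ≤ h y) → (∀ {y z} → y ≤ z → h y ≤ h z) →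
             ∀ {m n} x → m ≤ n → iter m h x ≤ iter n h x
iter-monoˡ h≥ h-mono x (z≤n {n}) = iter-inflationary h≥ n x
iter-monoˡ h≥ h-mono x (s≤s m≤n) = h-mono (iter-monoˡ h≥ h-mono x m≤n)

n+x≤iter : ∀ {h : ℕ → ℕ} → (∀ y → suc y ≤ h y) → ∀ n x → n + x ≤ iter n h x
n+x≤iter h> zero    x = ≤-refl
n+x≤iter h> (suc n) x = ≤-trans (s≤s (n+x≤iter h> n x)) (h> _)

x<FB : ∀ a x → suc x ≤ FB a x
x<FB bz     x = ≤-refl
x<FB (bs a) x =
  ≤-trans (s≤s (iter-inflationary (λ y → <⇒≤ (x<FB a y)) x x)) (x<FB a (iter x (FB a) x))
x<FB (bl f) x = x<FB (f x) x

x≤FB : ∀ a x → x ≤ FB a x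
x≤FB a x = <⇒≤ (x<FB a x)

mutual
  FB-mono : ∀ {a} → Regular a → ∀ {x y} → x ≤ y → FB a x ≤ FB a y
  FB-mono reg-zero x≤y = s≤s x≤y
  FB-mono (reg-suc {a} r) {x} {y} x≤y =
    ≤-trans (iter-mono (FB-mono r) (suc x) x≤y) (iter-monoˡ (x≤FB a) (FB-mono r) y (s≤s x≤y))
  FB-mono (reg-lim rf inc _) {x} {y} x≤y =
    ≤-trans (FB-mono (rf x) x≤y) (FB-dom (rf y) (≼-chain (λ n → inc n y) x≤y) ≤-refl)

  FB-dom : ∀ {a b n x} → Regular a → b ≼[ n ] a → n ≤ x → FB b x ≤ FB a x
  FB-dom _ ≼-refl _ = ≤-refl
  FB-dom {x = x} (reg-suc {a} r) (≼-suc p) n≤x =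
    ≤-trans (FB-dom r p n≤x) (FB-mono r (iter-inflationary (x≤FB a) x x))
  FB-dom {x = x} (reg-lim rf inc _) (≼-lim {n = n} p) n≤x =
    ≤-trans (FB-dom (rf n) p n≤x) (FB-dom (rf x) (≼-chain (λ k → inc k x) n≤x) ≤-refl)

FB≤FB-suc-suc : ∀ {a} → Regular a → ∀ {x y} → y ≤ FB (bs a) x → FB a y ≤ FB (bs a) (suc x)
FB≤FB-suc-suc r {x} y≤ = FB-mono r (≤-trans y≤ (iter-mono (FB-mono r) (suc x) (n≤1+n x)))

FB∘FB≤FB∘suc : ∀ {a b N x} → Regular a → bs b ≼[ N ] a → N ≤ x → FB b (FB a x) ≤ FB a (suc x)
FB∘FB≤FB∘suc {x = x} (reg-suc {a} r) q N≤x =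
  ≤-trans (FB-dom r (suc≼suc⇒≼ q) (≤-trans N≤x (x≤FB (bs a) x))) (FB≤FB-suc-suc r {x} ≤-refl)
FB∘FB≤FB∘suc {b = b} {N} {x} (reg-lim {f} rf inc bach) (≼-lim p) N≤x = begin
  FB b (FB (f x) x)          ≤⟨ FB-dom (rf x) (suc≼⇒≼ (≼-trans p (≼-chain (λ k → inc k N) N≤x)))
                                       (≤-trans N≤x (x≤FB (f x) x)) ⟩
  FB (f x) (FB (f x) x)      ≤⟨ FB≤FB-suc-suc (rf x) {x}
                                  (FB-mono (rf x) (iter-inflationary (x≤FB (f x)) x x)) ⟩
  FB (bs (f x)) (suc x)      ≤⟨ FB-dom (rf (suc x)) (bach x x) ≤-refl ⟩
  FB (f (suc x)) (suc x)     ∎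
  where open ≤-Reasoning

one : Ord
one = ω^ 𝟎 + 𝟎

F₁-closed : ∀ y → F one y ≡ suc (y + y)
F₁-closed y = iter-suc (suc y) y
  where
    iter-suc : ∀ n x → iter n suc x ≡ n + x
    iter-suc zero    x = refl
    iter-suc (suc n) x = cong suc (iter-suc n x)

Unary : Ord → (ℕ → ℕ) → Set
Unary β g = Grz β 1 (λ v → g (head v))

unary-id : ∀ {β} → Unary β (λ x → x)
unary-id = extG (projG fz) (λ { (x ∷ []) → refl })

unary-∘ : ∀ {β} h g → Unary β h → Unary β g → Unary β (λ x → h (g x))
unary-∘ h g uh ug = compG {gs = λ _ v → g (head v)} uh (λ _ → ug)

unary-+ : ∀ {β} g₁ g₂ → Unary β g₁ → Unary β g₂ → Unary β (λ x → g₁ x + g₂ x)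
unary-+ {β} g₁ g₂ u₁ u₂ = compG {gs = args} addG unary-args
  where
    args : Fin 2 → Vec ℕ 1 → ℕ
    args fz      v = g₁ (head v)
    args (fs fz) v = g₂ (head v)
    unary-args : ∀ i → Grz β 1 (args i)
    unary-args fz      = u₁
    unary-args (fs fz) = u₂

unary-iterF : ∀ {β} n → Unary β (iter n (F β))
unary-iterF zero    = unary-id
unary-iterF {β} (suc n) = unary-∘ (F β) (iter n (F β)) FG (unary-iterF n)

sumFin : (m : ℕ) → (Fin m → ℕ → ℕ) → ℕ → ℕ
sumFin zero    gs x = 0
sumFin (suc m) gs x = gs fz x + sumFin m (λ i → gs (fs i)) x

unary-sumFin : ∀ {β} m (gs : Fin m → ℕ → ℕ) → (∀ i → Unary β (gs i)) → Unary β (sumFin m gs)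
unary-sumFin zero    gs us = zeroG
unary-sumFin (suc m) gs us =
  unary-+ (gs fz) (sumFin m (λ i → gs (fs i)))
          (us fz) (unary-sumFin m (λ i → gs (fs i)) (λ i → us (fs i)))

≤-sumFin : ∀ m (gs : Fin m → ℕ → ℕ) i x → gs i x ≤ sumFin m gs x
≤-sumFin (suc m) gs fz     x = m≤m+n _ _
≤-sumFin (suc m) gs (fs i) x = ≤-trans (≤-sumFin m (λ j → gs (fs j)) i x) (m≤n+m _ _)

lookup≤vmax : ∀ {k} (v : Vec ℕ k) i → lookup v i ≤ vmax v
lookup≤vmax (x ∷ v) fz     = m≤m⊔n x (vmax v)
lookup≤vmax (x ∷ v) (fs i) = ≤-trans (lookup≤vmax v i) (m≤n⊔m x (vmax v))

vmax-tabulate-≤ : ∀ {k} (t : Fin k → ℕ) {c} → (∀ i → t i ≤ c) → vmax (tabulate t) ≤ c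
vmax-tabulate-≤ {zero}  t t≤c = z≤n
vmax-tabulate-≤ {suc k} t t≤c =
  ⊔-lub (t≤c fz) (vmax-tabulate-≤ (λ i → t (fs i)) (λ i → t≤c (fs i)))

record Majorant (α β : Ord) (h : ℕ → ℕ) : Set where
  constructor majorant
  field
    g     : ℕ → ℕ
    unary : Unary β g
    bound : ∀ x → h (F α x) ≤ F α (g x)

module Majorisation (α β : Ord)
  (double : Majorant α β (λ y → y + y)) (Fβ : Majorant α β (F β)) where

  VecMajorant : (k : ℕ) → (Vec ℕ k → ℕ) → Set
  VecMajorant k f = Σ (ℕ → ℕ) λ g → Unary β g × (∀ x v → vmax v ≤ F α x → f v ≤ F α (g x))

  majorise : ∀ {k f} → Grz β k f → VecMajorant k f
  majorise zeroG = (λ _ → 0) , zeroG , λ _ _ _ → z≤n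
  majorise addG = g , unary , λ x v v≤ →
    ≤-trans (+-mono-≤ (≤-trans (lookup≤vmax v fz) v≤) (≤-trans (lookup≤vmax v (fs fz)) v≤)) (bound x)
    where open Majorant double
  majorise (projG i) = (λ x → x) , unary-id , λ x v v≤ → ≤-trans (lookup≤vmax v i) v≤
  majorise FG = g , unary , λ { x (y ∷ []) v≤ →
    ≤-trans (FB-mono (Regular-toB β) (≤-trans (m≤m⊔n y 0) v≤)) (bound x) }
    where open Majorant Fβ
  majorise (compG {m = m} {gs = gs} dh dgs) with majorise dh
  ... | gh , uh , h≤ = (λ x → gh (S x)) , unary-∘ gh S uh (unary-sumFin m G unary-G) ,
    λ x v v≤ → h≤ (S x) (tabulate (λ i → gs i v)) (vmax-tabulate-≤ _ λ i →
      ≤-trans (G-bound i x v v≤) (FB-mono (Regular-toB α) (≤-sumFin m G i x)))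
    where
      G : Fin m → ℕ → ℕ
      G i = proj₁ (majorise (dgs i))
      unary-G : ∀ i → Unary β (G i)
      unary-G i = proj₁ (proj₂ (majorise (dgs i)))
      G-bound : ∀ i x v → vmax v ≤ F α x → gs i v ≤ F α (G i x)
      G-bound i = proj₂ (proj₂ (majorise (dgs i)))
      S : ℕ → ℕ
      S = sumFin m G
  majorise (lprecG _ _ db bounded) with majorise db
  ... | g , ug , b≤ = g , ug , λ x v v≤ → ≤-trans (bounded v) (b≤ x (vmax v ∷ []) (⊔-lub v≤ z≤n))
  majorise (extG d f≗f') with majorise d
  ... | g , ug , f≤ = g , ug , λ x v v≤ → subst (_≤ F α (g x)) (f≗f' v) (f≤ x v v≤)

Majorant-≤ : ∀ {α β h h'} → (∀ y → h y ≤ h' y) → Majorant α β h' → Majorant α β h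
Majorant-≤ h≤h' (majorant g ug bound) = majorant g ug (λ x → ≤-trans (h≤h' _) (bound x))

majorant-via-≼ : ∀ α β {b N} → Regular b → bs b ≼[ N ] toB α → Majorant α β (FB b)
majorant-via-≼ α β {b} {N} rb q = majorant (iter (suc N) (F β)) (unary-iterF (suc N)) bound
  where
    F-mono = FB-mono (Regular-toB α)
    open ≤-Reasoning
    bound : ∀ x → FB b (F α x) ≤ F α (iter (suc N) (F β) x)
    bound x = begin
      FB b (F α x)               ≤⟨ FB-mono rb (F-mono (m≤n+m x N)) ⟩
      FB b (F α (N + x))         ≤⟨ FB∘FB≤FB∘suc (Regular-toB α) q (m≤m+n N x) ⟩
      F α (suc N + x)            ≤⟨ F-mono (n+x≤iter (x<FB (toB β)) (suc N) x) ⟩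
      F α (iter (suc N) (F β) x) ∎

F-majorant : ∀ {α β} → IsCNF β → β <ₒ α → Majorant α β (F β)
F-majorant {α} {β} cβ β<α with <ₒ⇒suc≼ cβ β<α
... | N , q = majorant-via-≼ α β (Regular-toB β) q

F₁-majorant-above-one : ∀ α β → one <ₒ α → Majorant α β (F one)
F₁-majorant-above-one α β 1<α with <ₒ⇒suc≼ (cnfω cnf0 cnf0 lz) 1<α
... | N , q = majorant-via-≼ α β (reg-suc reg-zero) q

-- For α = 1 majorant-via-≼ does not apply (2 ⋠ 1); F₁ y = 2y + 1 is majorised directly.
F₁-majorant : ∀ α β → β <ₒ α → Majorant α β (F one)
F₁-majorant 𝟎 β ()
F₁-majorant (ω^ 𝟎 + 𝟎) β _ =
  majorant g (unary-+ (F β) (λ x → x + x) FG (unary-+ (λ x → x) (λ x → x) unary-id unary-id))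
           (λ x → FB-mono (Regular-toB one) (F₁≤g x))
  where
    g : ℕ → ℕ
    g x = F β x + (x + x)
    F₁≤g : ∀ x → F one x ≤ g x
    F₁≤g x rewrite F₁-closed x = +-mono-≤ (x<FB (toB β) x) (m≤n+m x x)
F₁-majorant α@(ω^ 𝟎 + (ω^ _ + _))   β _ = F₁-majorant-above-one α β (tl< 0<ω)
F₁-majorant α@(ω^ (ω^ _ + _) + _) β _ = F₁-majorant-above-one α β (exp< 0<ω)

double-majorant : ∀ {α β} → β <ₒ α → Majorant α β (λ y → y + y)
double-majorant {α} {β} β<α = Majorant-≤ y+y≤F₁ (F₁-majorant α β β<α)
  where
    y+y≤F₁ : ∀ y → y + y ≤ F one y
    y+y≤F₁ y = ≤-trans (n≤1+n (y + y)) (≤-reflexive (sym (F₁-closed y)))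

-- Regular-toB holds for every notation, so α need not be in normal form.
corollaryA7 : (α : Ord) → IsCNF α → (f : ℕ → ℕ) →
    Grz< α 1 (λ v → f (head v)) →
    Σ (ℕ → ℕ) (λ g → Grz< α 1 (λ v → g (head v)) × (∀ x → f (F α x) ≤ F α (g x)))
corollaryA7 α _ f (β , cβ , β<α , f∈𝓕β)
  with Majorisation.majorise α β (double-majorant β<α) (F-majorant cβ β<α) f∈𝓕β
... | g , ug , bound = g , (β , cβ , β<α , ug) , λ x → bound x (F α x ∷ []) (⊔-lub ≤-refl z≤n)
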